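{- Let $g,g'$ be positive integers and let $A,A'$ be sets of integers such that $A+g\subset A$ and $A'+g'\subset A'$. Then $A-A'$ is fully periodic modulo $\gcd(g,g')$, i.e. $(A-A')+\gcd(g,g')=A-A'$.
   Context: $A-A'=\{x-x'\mid x\in A,x'\in A'\}$ and $A+g=\{x+g\mid x\in A\}$. A set $A$ with $A+g\subset A$ is called semi-periodic modulo $g$; with $A+g=A$ it is called fully periodic modulo $g$. -}

module Defs where

open import Level using (0ℓ)
open import Data.Integer using (ℤ; _+_; _-_)
open import Data.Product using (∃; ∃₂; _×_)
open import Relation.Unary using (Pred)
open import Relation.Binary.PropositionalEquality using (_≡_)

SetZ : Set₁
SetZ = Pred ℤ 0ℓ

_+ₛ_ : SetZ → ℤ → SetZ
(A +ₛ g) z = ∃ λ x → A x × z ≡ x + g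

_-ₛ_ : SetZ → SetZ → SetZ
(A -ₛ A') z = ∃₂ λ x x' → A x × A' x' × z ≡ x - x'

module Submission where

-- Write  Rep g g' t  when the integer t is a difference  m·g − n·g'
-- of non-negative multiples of g and g'.
--   * A set that is semi-periodic modulo g is closed under adding every
--     non-negative multiple k·g (iterate the hypothesis).
--   * Hence, if A is semi-periodic modulo g and A' modulo g', then A − A' is
--     closed under the shift by every t with Rep g g' t:
--       (x − x') + (m·g − n·g') = (x + m·g) − (x' + n·g').
--   * For g, g' > 0 the class Rep g g' is closed under negation, via the identity
--       −(m·g − n·g') = (m·(g'−1) + n·g')·g − (m·g + n·(g−1))·g'.
--   * Bézout's identity gives Rep g g' (gcd g g') or Rep g g' (−gcd g g'),
--     so both ±gcd g g' are representable.
--   * A set closed under the shifts by t and by −t is fully periodic modulo t.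
-- The theorem applies the last fact to B = A − A' and t = gcd g g'.

open import Defs
open import Data.Nat using (ℕ; _<_)
open import Data.Nat.GCD using (gcd)
open import Data.Integer using (+_)
open import Relation.Unary using (_⊆_; _≐_)

open import Data.Nat as ℕ using (zero; suc)
open import Data.Nat.GCD using (module Bézout; gcd-GCD)
open import Data.Integer using (ℤ; -_; _+_; _-_; _*_)
open import Data.Integer.Properties using (pos-+; pos-*; +-identityʳ; neg-involutive)
open import Data.Product using (∃₂; _,_)
open import Relation.Binary.PropositionalEquality using (_≡_; refl; sym; trans; cong; cong₂; subst; module ≡-Reasoning)
import Data.Integer.Tactic.RingSolver as ℤ-Ring

Rep : ℕ → ℕ → ℤ → Set
Rep g g' t = ∃₂ λ m n → t ≡ + (m ℕ.* g) - + (n ℕ.* g')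

nat-sum⇒int-diff : ∀ {a b c} → a ℕ.+ b ≡ c → + a ≡ + c - + b
nat-sum⇒int-diff {a} {b} refl = trans (add-sub (+ a) (+ b)) (cong (_- + b) (sym (pos-+ a b)))
  where
  add-sub : ∀ i j → i ≡ (i + j) - j
  add-sub = ℤ-Ring.solve-∀

semiPeriodic-multiple : ∀ {g} (A : SetZ) → (A +ₛ (+ g)) ⊆ A → ∀ k → (A +ₛ (+ (k ℕ.* g))) ⊆ A
semiPeriodic-multiple A closed zero    (x , ax , refl) = subst A (sym (+-identityʳ x)) ax
semiPeriodic-multiple {g} A closed (suc k) (x , ax , refl) =
  closed (x + + (k ℕ.* g) , semiPeriodic-multiple A closed k (x , ax , refl) , regroup)
  where
  shift-assoc : ∀ i j l → i + (j + l) ≡ (i + l) + j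
  shift-assoc = ℤ-Ring.solve-∀
  regroup : x + + (g ℕ.+ k ℕ.* g) ≡ (x + + (k ℕ.* g)) + + g
  regroup = trans (cong (λ i → x + i) (pos-+ g (k ℕ.* g))) (shift-assoc x (+ g) (+ (k ℕ.* g)))

-- A − A' is closed under every shift m·g − n·g', by moving x up by m·g and x' up by n·g'.
difference-closed : ∀ {g g' t} (A A' : SetZ) → (A +ₛ (+ g)) ⊆ A → (A' +ₛ (+ g')) ⊆ A' →
                    Rep g g' t → ((A -ₛ A') +ₛ t) ⊆ (A -ₛ A')
difference-closed {g} {g'} A A' closed closed' (m , n , refl) (_ , (x , x' , ax , ax' , refl) , refl) =
  x + + (m ℕ.* g) , x' + + (n ℕ.* g') ,
  semiPeriodic-multiple A closed m (x , ax , refl) ,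
  semiPeriodic-multiple A' closed' n (x' , ax' , refl) ,
  interchange x x' (+ (m ℕ.* g)) (+ (n ℕ.* g'))
  where
  interchange : ∀ i i' j j' → (i - i') + (j - j') ≡ (i + j) - (i' + j')
  interchange = ℤ-Ring.solve-∀

pos-*-suc : ∀ a b → + (a ℕ.* suc b) ≡ + a * (+ 1 + + b)
pos-*-suc a b = trans (pos-* a (suc b)) (cong (λ i → + a * i) (pos-+ 1 b))

-- For positive moduli, representable shifts are closed under negation:
--   −(m·g − n·g') = (m·(g'−1) + n·g')·g − (m·g + n·(g−1))·g'.
Rep-neg : ∀ {h h' t} → Rep (suc h) (suc h') t → Rep (suc h) (suc h') (- t)
Rep-neg {h} {h'} (m , n , refl) = m' , n' , (begin
    - (+ (m ℕ.* suc h) - + (n ℕ.* suc h'))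
      ≡⟨ cong -_ (cong₂ _-_ (pos-*-suc m h) (pos-*-suc n h')) ⟩
    - (M * G - N * G')
      ≡⟨ negation-identity M N H H' ⟩
    (M * H' + N * G') * G - (M * G + N * H) * G'
      ≡⟨ sym (cong₂ _-_ m'-embeds n'-embeds) ⟩
    + (m' ℕ.* suc h) - + (n' ℕ.* suc h') ∎)
  where
  open ≡-Reasoning
  m' n' : ℕ
  m' = m ℕ.* h' ℕ.+ n ℕ.* suc h'
  n' = m ℕ.* suc h ℕ.+ n ℕ.* h
  M N H H' G G' : ℤ
  M = + m ; N = + n ; H = + h ; H' = + h'
  G = + 1 + H ; G' = + 1 + H'
  negation-identity : ∀ a b c c' →
    - (a * (+ 1 + c) - b * (+ 1 + c')) ≡
    (a * c' + b * (+ 1 + c')) * (+ 1 + c) - (a * (+ 1 + c) + b * c) * (+ 1 + c')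
  negation-identity = ℤ-Ring.solve-∀
  m'-embeds : + (m' ℕ.* suc h) ≡ (M * H' + N * G') * G
  m'-embeds = trans (pos-*-suc m' h)
    (cong (_* G) (trans (pos-+ (m ℕ.* h') (n ℕ.* suc h')) (cong₂ _+_ (pos-* m h') (pos-*-suc n h'))))
  n'-embeds : + (n' ℕ.* suc h') ≡ (M * G + N * H) * G'
  n'-embeds = trans (pos-*-suc n' h')
    (cong (_* G') (trans (pos-+ (m ℕ.* suc h) (n ℕ.* h)) (cong₂ _+_ (pos-*-suc m h) (pos-* n h))))

gcd-Rep : ∀ h h' → Rep (suc h) (suc h') (+ gcd (suc h) (suc h'))
gcd-Rep h h' with Bézout.identity {suc h} {suc h'} (gcd-GCD (suc h) (suc h'))
... | Bézout.+- x y eq = x , y , nat-sum⇒int-diff eq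
... | Bézout.-+ x y eq = subst (Rep (suc h) (suc h')) (neg-involutive _) (Rep-neg (x , y , neg-gcd))
  where
  neg-sub : ∀ i j → - (i - j) ≡ j - i
  neg-sub = ℤ-Ring.solve-∀
  neg-gcd : - + gcd (suc h) (suc h') ≡ + (x ℕ.* suc h) - + (y ℕ.* suc h')
  neg-gcd = trans (cong -_ (nat-sum⇒int-diff eq)) (neg-sub (+ (y ℕ.* suc h')) (+ (x ℕ.* suc h)))

closed-both-ways⇒periodic : ∀ {t} (B : SetZ) → (B +ₛ t) ⊆ B → (B +ₛ (- t)) ⊆ B → (B +ₛ t) ≐ B
closed-both-ways⇒periodic {t} B up down = up , λ {z} bz → z - t , down (z , bz , refl) , sym (sub-add z t)
  where
  sub-add : ∀ i j → (i - j) + j ≡ i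
  sub-add = ℤ-Ring.solve-∀

lemma5p1 : (g g' : ℕ) → 0 < g → 0 < g' → (A A' : SetZ) →
    (A +ₛ (+ g)) ⊆ A → (A' +ₛ (+ g')) ⊆ A' →
    ((A -ₛ A') +ₛ (+ gcd g g')) ≐ (A -ₛ A')
lemma5p1 (suc h) (suc h') _ _ A A' closed closed' =
  closed-both-ways⇒periodic (A -ₛ A')
    (difference-closed A A' closed closed' gcd-shift)
    (difference-closed A A' closed closed' (Rep-neg gcd-shift))
  where
  gcd-shift : Rep (suc h) (suc h') (+ gcd (suc h) (suc h'))
  gcd-shift = gcd-Rep h h'
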